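{- Let $\mathcal{L}\subseteq\mathbf{Z}^n$ be a lattice. Then $\mathrm{rad}(P_{\mathcal{L}})=\mathrm{rad}(V_{\mathcal{L}})$. Moreover, $\mathrm{Top}(P_{\mathcal{L}})\subseteq\mathrm{Top}(V_{\mathcal{L}})$.
   Context: $S=k[x_1,\ldots,x_n]$, $x^u=\prod_i x_i^{u_i}$. For $u\in\mathbf{N}^n$ the fiber is $P_u=\mathrm{conv}\{v\in\mathbf{N}^n: u-v\in\mathcal{L}\}$; the vertex ideal $V_{\mathcal{L}}$ is the monomial ideal spanned by monomials $x^v$ with $v$ not a vertex of $P_v$. The Graver basis $Gr_{\mathcal{L}}$ is the union over all closed orthants $\mathbf{R}_\rho$ of the Hilbert bases (unique minimal monoid generating sets) of $\mathcal{L}\cap\mathbf{R}_\rho$; the product ideal is $P_{\mathcal{L}}=\langle x^ux^v: u,v\in\mathbf{N}^n \text{ with disjoint supports},\ u-v\in Gr_{\mathcal{L}}\rangle$. For an ideal $M$, $\mathrm{Top}(M)$ is the intersection of the primary components of $M$ corresponding to its associated primes of maximal dimension (these are minimal primes, so the components are uniquely determined). -}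

module Defs where

open import Data.Nat as ℕ using (ℕ; zero; suc; _≤_; _<_)
open import Data.Integer as ℤ using (ℤ; +_; _≥_)
open import Data.Fin using (Fin; zero; suc)
open import Data.Fin.Subset using (Subset; _∈_; ∣_∣)
open import Data.Bool using (Bool; true; false)
open import Data.Product using (Σ; ∃; _×_; Σ-syntax; ∃-syntax)
open import Data.Sum using (_⊎_)
open import Relation.Binary.PropositionalEquality using (_≡_; _≢_)
open import Relation.Nullary using (¬_)

-- exponent vectors u ∈ ℕⁿ  (the monomial x^u)
ℕVec : ℕ → Set
ℕVec n = Fin n → ℕ

ℤVec : ℕ → Set
ℤVec n = Fin n → ℤ

sumℕ : ∀ {k} → (Fin k → ℕ) → ℕ
sumℕ {zero}  f = 0
sumℕ {suc k} f = f zero ℕ.+ sumℕ (λ j → f (suc j))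

sumℤ : ∀ {k} → (Fin k → ℤ) → ℤ
sumℤ {zero}  f = + 0
sumℤ {suc k} f = f zero ℤ.+ sumℤ (λ j → f (suc j))

_+ᵥ_ : ∀ {n} → ℕVec n → ℕVec n → ℕVec n
(u +ᵥ v) i = u i ℕ.+ v i

_*ᵥ_ : ∀ {n} → ℕ → ℕVec n → ℕVec n
(m *ᵥ u) i = m ℕ.* u i

_-ᵥ_ : ∀ {n} → ℕVec n → ℕVec n → ℤVec n
(u -ᵥ v) i = (+ u i) ℤ.- (+ v i)

-- componentwise order on ℕⁿ (x^u divides x^w)
_≤ᵥ_ : ∀ {n} → ℕVec n → ℕVec n → Set
u ≤ᵥ w = ∀ i → u i ≤ w i

-- Lattices: a lattice 𝓛 ⊆ ℤⁿ (a subgroup of ℤⁿ) is given by a finite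
-- list of generators B 0, …, B (m-1); every subgroup of ℤⁿ is of this form.

InLattice : ∀ {n m} → (Fin m → ℤVec n) → ℤVec n → Set
InLattice {n} {m} B v =
  Σ[ c ∈ (Fin m → ℤ) ] (∀ i → v i ≡ sumℤ (λ j → c j ℤ.* B j i))

InFiber : ∀ {n m} → (Fin m → ℤVec n) → ℕVec n → ℕVec n → Set
InFiber B u v = InLattice B (u -ᵥ v)

-- Convex coefficients are rational
-- (equivalently real, since all points are integral); after clearing
-- denominators they are natural numbers λ_j with Σ λ_j > 0 and
-- (Σ λ_j) · v = Σ λ_j · w_j.
ConvCombOfOthers : ∀ {n m} → (Fin m → ℤVec n) → ℕVec n → ℕVec n → Set
ConvCombOfOthers {n} B u v =
  Σ[ k ∈ ℕ ] Σ[ w ∈ (Fin k → ℕVec n) ] Σ[ λ′ ∈ (Fin k → ℕ) ]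
    ( (∀ j → InFiber B u (w j))
    × (∀ j → ¬ (∀ i → w j i ≡ v i))
    × (0 < sumℕ λ′)
    × (∀ i → sumℕ λ′ ℕ.* v i ≡ sumℕ (λ j → λ′ j ℕ.* w j i)) )

-- v (a point of the fiber of u) is a vertex of P_u = conv(fiber of u):
-- it is an extreme point, i.e. not a convex combination of other points.
IsVertexOfFiber : ∀ {n m} → (Fin m → ℤVec n) → ℕVec n → ℕVec n → Set
IsVertexOfFiber B u v = InFiber B u v × ¬ ConvCombOfOthers B u v

-- Monomial ideals of S = k[x_1,…,x_n] are represented by the set of
-- exponent vectors of the monomials they contain.

MonIdeal : ℕ → Set₁
MonIdeal n = ℕVec n → Set

-- vertex ideal V_𝓛 : (generated by) x^v with v not a vertex of P_v
VertexIdeal : ∀ {n m} → (Fin m → ℤVec n) → MonIdeal n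
VertexIdeal B w = Σ[ v ∈ ℕVec _ ] (v ≤ᵥ w × ¬ IsVertexOfFiber B v v)

-- closed orthant R_ρ, ρ a sign pattern (true = nonnegative, false = nonpositive)
InOrthant : ∀ {n} → (Fin n → Bool) → ℤVec n → Set
InOrthant ρ g = ∀ i → OrthCond (ρ i) (g i)
  where
  OrthCond : Bool → ℤ → Set
  OrthCond true  x = x ℤ.≥ + 0
  OrthCond false x = x ℤ.≤ + 0

NonZero : ∀ {n} → ℤVec n → Set
NonZero g = ¬ (∀ i → g i ≡ + 0)

_+ℤᵥ_ : ∀ {n} → ℤVec n → ℤVec n → ℤVec n
(a +ℤᵥ b) i = a i ℤ.+ b i

InHilbertBasis : ∀ {n m} → (Fin m → ℤVec n) → (Fin n → Bool) → ℤVec n → Set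
InHilbertBasis {n} B ρ g =
  InLattice B g × InOrthant ρ g × NonZero g ×
  ¬ (Σ[ a ∈ ℤVec n ] Σ[ b ∈ ℤVec n ]
       ( InLattice B a × InOrthant ρ a × NonZero a
       × InLattice B b × InOrthant ρ b × NonZero b
       × (∀ i → g i ≡ (a +ℤᵥ b) i)))

InGraver : ∀ {n m} → (Fin m → ℤVec n) → ℤVec n → Set
InGraver {n} B g = Σ[ ρ ∈ (Fin n → Bool) ] InHilbertBasis B ρ g

-- product ideal P_𝓛 = ⟨ x^u x^v : disjoint supports, u - v ∈ Gr_𝓛 ⟩
ProductIdeal : ∀ {n m} → (Fin m → ℤVec n) → MonIdeal n
ProductIdeal {n} B w =
  Σ[ u ∈ ℕVec n ] Σ[ v ∈ ℕVec n ]
    ( (∀ i → u i ≡ 0 ⊎ v i ≡ 0)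
    × InGraver B (u -ᵥ v)
    × (u +ᵥ v) ≤ᵥ w )

Rad : ∀ {n} → MonIdeal n → MonIdeal n
Rad M w = Σ[ k ∈ ℕ ] (0 < k × M (k *ᵥ w))

-- M ⊆ P_F = ⟨ x_i : i ∈ F ⟩
⊆Prime : ∀ {n} → MonIdeal n → Subset n → Set
⊆Prime M F = ∀ u → M u → Σ[ i ∈ Fin _ ] (i ∈ F × 0 < u i)

-- P_F is an associated prime of M of maximal dimension (n - |F|):
-- a prime containing M of minimal height |F| (such primes are exactly
-- the minimal primes of M of maximal dimension).
TopPrime : ∀ {n} → MonIdeal n → Subset n → Set
TopPrime M F = ⊆Prime M F × (∀ G → ⊆Prime M G → ∣ F ∣ ≤ ∣ G ∣)

-- the P_F-primary component of M for a minimal prime P_F is M S_{P_F} ∩ S;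
-- on monomials: x^u ∈ it iff x^u x^w ∈ M for some x^w ∉ P_F.
PrimaryComponent : ∀ {n} → MonIdeal n → Subset n → MonIdeal n
PrimaryComponent {n} M F u =
  Σ[ w ∈ ℕVec n ] ((∀ i → i ∈ F → w i ≡ 0) × M (u +ᵥ w))

Top : ∀ {n} → MonIdeal n → MonIdeal n
Top M u = ∀ F → TopPrime M F → PrimaryComponent M F u

_≐_ : ∀ {n} → MonIdeal n → MonIdeal n → Set
M ≐ N = ∀ u → (M u → N u) × (N u → M u)

_⊆ᴵ_ : ∀ {n} → MonIdeal n → MonIdeal n → Set
M ⊆ᴵ N = ∀ u → M u → N u

{-# OPTIONS --safe #-}

-- If u − u′ is a Graver element with disjoint supports, then u + u′ is the
-- midpoint of 2u and 2u′, two other points of its fiber; so P_𝓛 ⊆ V_𝓛.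
-- Conversely, if v is not a vertex of P_v, a point w of the fiber with
-- positive weight in a convex combination giving v yields a nonzero lattice
-- vector y = v − w supported in supp v.  Splitting y conformally while its
-- ℓ¹-norm drops ends at a Graver element h with |h| ≤ |y|, and x^h⁺ x^h⁻
-- divides a power of x^v; so V_𝓛 ⊆ rad P_𝓛 and the radicals agree.  Equal
-- radicals have the same minimal primes, and localising P_𝓛 ⊆ V_𝓛 at them
-- gives Top(P_𝓛) ⊆ Top(V_𝓛).
--
-- The argument is made constructive by deciding lattice membership and
-- whether 𝓛 meets a coordinate subspace nontrivially, through Hermite-style
-- pivoting with Bézout coefficients.

module Submission where

open import Defs
open import Data.Bool using (Bool; true; false)
open import Data.Empty using (⊥-elim)
open import Data.Fin using (Fin; zero; suc; toℕ; fromℕ<)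
import Data.Fin.Properties as Finₚ
open import Data.Integer using (ℤ; +_; -[1+_]; +0; +[1+_]; ∣_∣; 0ℤ; 1ℤ; -1ℤ; _+_; _-_; _*_; -_; _≤_; _≥_; +≤+; -≤+)
import Data.Integer.Properties as ℤₚ
open import Data.Integer.Tactic.RingSolver using (solve-∀)
open import Data.List using (List; []; _∷_; map; tabulate; filter; allFin)
open import Data.List.Membership.Propositional using (_∈_; find)
open import Data.List.Membership.Propositional.Properties using (∈-filter⁺; ∈-filter⁻; ∈-allFin)
open import Data.List.Relation.Unary.All as All using (All; []; _∷_)
open import Data.List.Relation.Unary.All.Properties using (¬All⇒Any¬)
open import Data.List.Relation.Unary.Any using (here; there)
open import Data.Nat as ℕ using (ℕ; zero; suc; z≤n; s≤s)
open import Data.Nat.Divisibility using (divides; 0∣⇒≡0)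
import Data.Nat.GCD as ℕGCD
open import Data.Nat.Induction using (<-wellFounded)
import Data.Nat.Properties as ℕₚ
open import Data.Nat.Tactic.RingSolver using () renaming (solve-∀ to ℕ-solve-∀)
open import Data.Product using (Σ; ∃; _×_; _,_; proj₁; proj₂)
open import Data.Sum using (_⊎_; inj₁; inj₂)
open import Data.Vec.Functional using (head; tail) renaming ([] to []ᵥ; _∷_ to _∷ᵥ_)
open import Function using (_∘_)
open import Induction.WellFounded using (Acc; acc)
open import Level using (0ℓ)
open import Relation.Binary.PropositionalEquality
open import Relation.Nullary using (¬_; ¬?; Dec; yes; no)
open import Relation.Nullary.Decidable as Dec using (_×-dec_; _⊎-dec_)
open import Relation.Unary using (Pred; Decidable; _⊆_; _∩_)

private variable
  n m : ℕ


-- Integer arithmetic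

i≡j+k⇒i-j≡k : ∀ {i} j k → i ≡ j + k → i - j ≡ k
i≡j+k⇒i-j≡k j k refl = cancel j k
  where
  cancel : ∀ j k → j + k - j ≡ k
  cancel = solve-∀

i-j≡k⇒i≡j+k : ∀ i j {k} → i - j ≡ k → i ≡ j + k
i-j≡k⇒i≡j+k i j refl = regroup i j
  where
  regroup : ∀ i j → i ≡ j + (i - j)
  regroup = solve-∀

x-c*0≡x : ∀ x c → x - c * 0ℤ ≡ x
x-c*0≡x = solve-∀

_⁺ _⁻ : ℤ → ℕ
(+ a) ⁺ = a
-[1+ a ] ⁺ = 0
(+ a) ⁻ = 0
-[1+ a ] ⁻ = suc a

⁺-⁻ : ∀ z → + z ⁺ - + z ⁻ ≡ z
⁺-⁻ (+ a) = ℤₚ.+-identityʳ (+ a)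
⁺-⁻ -[1+ a ] = refl

⁺+⁻ : ∀ z → z ⁺ ℕ.+ z ⁻ ≡ ∣ z ∣
⁺+⁻ (+ a) = ℕₚ.+-identityʳ a
⁺+⁻ -[1+ a ] = refl

⁺≡0⊎⁻≡0 : ∀ z → z ⁺ ≡ 0 ⊎ z ⁻ ≡ 0
⁺≡0⊎⁻≡0 (+ a) = inj₂ refl
⁺≡0⊎⁻≡0 -[1+ a ] = inj₁ refl

record Bézout (a b : ℤ) : Set where
  field
    d α β s t : ℤ
    a≡αd : a ≡ α * d
    b≡βd : b ≡ β * d
    αs+βt≡1 : α * s + β * t ≡ 1ℤ

private
  cancel-gcd : ∀ d x y q r → suc d ℕ.+ y ℕ.* (r ℕ.* suc d) ≡ x ℕ.* (q ℕ.* suc d) →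
               1ℤ + + y * + r ≡ + x * + q
  cancel-gcd d x y q r eq = begin
    1ℤ + + y * + r    ≡⟨ cong (λ z → 1ℤ + z) (ℤₚ.pos-* y r) ⟨
    + suc (y ℕ.* r)   ≡⟨ cong +_ (ℕₚ.*-cancelʳ-≡ _ _ (suc d)
                           (trans (expand d y r) (trans eq (assoc x q (suc d))))) ⟩
    + (x ℕ.* q)       ≡⟨ ℤₚ.pos-* x q ⟩
    + x * + q         ∎
    where
    open ≡-Reasoning
    expand : ∀ d y r → suc (y ℕ.* r) ℕ.* suc d ≡ suc d ℕ.+ y ℕ.* (r ℕ.* suc d)
    expand = ℕ-solve-∀
    assoc : ∀ x q e → x ℕ.* (q ℕ.* e) ≡ x ℕ.* q ℕ.* e
    assoc = ℕ-solve-∀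

  unit-combination : ∀ q r x y → 1ℤ + y * r ≡ x * q → q * x + r * - y ≡ 1ℤ
  unit-combination q r x y eq = begin
    q * x + r * - y      ≡⟨ regroup q r x y ⟩
    x * q - y * r        ≡⟨ cong (_- y * r) eq ⟨
    1ℤ + y * r - y * r   ≡⟨ cancel (y * r) ⟩
    1ℤ                   ∎
    where
    open ≡-Reasoning
    regroup : ∀ q r x y → q * x + r * - y ≡ x * q - y * r
    regroup = solve-∀
    cancel : ∀ z → 1ℤ + z - z ≡ 1ℤ
    cancel = solve-∀

  coprime-quotients : ∀ d q r → ℕGCD.Bézout.Identity (suc d) (q ℕ.* suc d) (r ℕ.* suc d) →
                      Σ ℤ λ s → Σ ℤ λ t → + q * s + + r * t ≡ 1ℤ
  coprime-quotients d q r (ℕGCD.Bézout.+- x y eq) =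
    + x , - + y , unit-combination (+ q) (+ r) (+ x) (+ y) (cancel-gcd d x y q r eq)
  coprime-quotients d q r (ℕGCD.Bézout.-+ x y eq) =
    - + x , + y ,
    trans (ℤₚ.+-comm (+ q * - + x) _) (unit-combination (+ r) (+ q) (+ y) (+ x) (cancel-gcd d y x r q eq))

bézout-ℕ : ∀ m n → Bézout (+ m) (+ n)
bézout-ℕ m n with ℕGCD.Bézout.lemma m n
... | ℕGCD.Bézout.result zero gcd _ = record
  { d = 0ℤ ; α = 1ℤ ; β = 0ℤ ; s = 1ℤ ; t = 0ℤ
  ; a≡αd = cong +_ (0∣⇒≡0 (proj₁ (ℕGCD.GCD.commonDivisor gcd)))
  ; b≡βd = cong +_ (0∣⇒≡0 (proj₂ (ℕGCD.GCD.commonDivisor gcd)))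
  ; αs+βt≡1 = refl }
... | ℕGCD.Bézout.result (suc d) gcd identity with ℕGCD.GCD.commonDivisor gcd
...   | divides q refl , divides r refl =
  let s , t , αs+βt≡1 = coprime-quotients d q r identity in record
  { d = + suc d ; α = + q ; β = + r ; s = s ; t = t
  ; a≡αd = ℤₚ.pos-* q (suc d) ; b≡βd = ℤₚ.pos-* r (suc d) ; αs+βt≡1 = αs+βt≡1 }

bézout-negˡ : ∀ {a b} → Bézout a b → Bézout (- a) b
bézout-negˡ {a} {b} bz = record
  { d = d ; α = - α ; β = β ; s = - s ; t = t
  ; a≡αd = trans (cong -_ a≡αd) (ℤₚ.neg-distribˡ-* α d)
  ; b≡βd = b≡βd
  ; αs+βt≡1 = trans (neg-*-neg α s (β * t)) αs+βt≡1 }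
  where
  open Bézout bz
  neg-*-neg : ∀ α s u → - α * - s + u ≡ α * s + u
  neg-*-neg = solve-∀

bézout-sym : ∀ {a b} → Bézout a b → Bézout b a
bézout-sym bz = record
  { d = d ; α = β ; β = α ; s = t ; t = s ; a≡αd = b≡βd ; b≡βd = a≡αd
  ; αs+βt≡1 = trans (ℤₚ.+-comm (β * t) _) αs+βt≡1 }
  where open Bézout bz

bézout : ∀ a b → Bézout a b
bézout (+ m) (+ n) = bézout-ℕ m n
bézout (+ m) -[1+ n ] = bézout-sym (bézout-negˡ (bézout-sym (bézout-ℕ m (suc n))))
bézout -[1+ m ] (+ n) = bézout-negˡ (bézout-ℕ (suc m) n)
bézout -[1+ m ] -[1+ n ] = bézout-negˡ (bézout-sym (bézout-negˡ (bézout-sym (bézout-ℕ (suc m) (suc n)))))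


-- Finite sums and bounded search

term≤sum : ∀ {k} (f : Fin k → ℕ) i → f i ℕ.≤ sumℕ f
term≤sum f zero = ℕₚ.m≤m+n _ _
term≤sum f (suc i) = ℕₚ.≤-trans (term≤sum (f ∘ suc) i) (ℕₚ.m≤n+m _ (f zero))

sum-+ : ∀ {k} (f g : Fin k → ℕ) → sumℕ (λ i → f i ℕ.+ g i) ≡ sumℕ f ℕ.+ sumℕ g
sum-+ {zero} f g = refl
sum-+ {suc k} f g = trans (cong (f zero ℕ.+ g zero ℕ.+_) (sum-+ (f ∘ suc) (g ∘ suc))) (interchange (f zero) (g zero) _ _)
  where
  interchange : ∀ a b c d → a ℕ.+ b ℕ.+ (c ℕ.+ d) ≡ a ℕ.+ c ℕ.+ (b ℕ.+ d)
  interchange = ℕ-solve-∀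

sum-cong : ∀ {k} {f g : Fin k → ℕ} → f ≗ g → sumℕ f ≡ sumℕ g
sum-cong {zero} f≗g = refl
sum-cong {suc k} f≗g = cong₂ ℕ._+_ (f≗g zero) (sum-cong (f≗g ∘ suc))

sum>0⇒term>0 : ∀ {k} (f : Fin k → ℕ) → 0 ℕ.< sumℕ f → ∃ λ i → 0 ℕ.< f i
sum>0⇒term>0 {suc k} f sum>0 with f zero in f₀≡
... | suc _ = zero , subst (0 ℕ.<_) (sym f₀≡) (s≤s z≤n)
... | zero = let i , fᵢ>0 = sum>0⇒term>0 (f ∘ suc) sum>0 in suc i , fᵢ>0

search-ℕ : ∀ k {P : Pred ℕ 0ℓ} → Decidable P → Dec (∃ λ j → j ℕ.≤ k × P j)
search-ℕ k {P} P? = Dec.map′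
  (λ (j , Pj) → toℕ j , ℕₚ.≤-pred (Finₚ.toℕ<n j) , Pj)
  (λ (j , j≤k , Pj) → fromℕ< (s≤s j≤k) , subst P (sym (Finₚ.toℕ-fromℕ< _)) Pj)
  (Finₚ.any? (P? ∘ toℕ))

search-ℤ : ∀ k {P : Pred ℤ 0ℓ} → Decidable P → Dec (∃ λ c → ∣ c ∣ ℕ.≤ k × P c)
search-ℤ k {P} P? = Dec.map′
  (λ where (j , j≤k , inj₁ P+j) → + j , j≤k , P+j
           (j , j≤k , inj₂ P-j) → - + j , subst (ℕ._≤ k) (sym (ℤₚ.∣-i∣≡∣i∣ (+ j))) j≤k , P-j)
  (λ where (+ j , j≤k , Pc) → j , j≤k , inj₁ Pc
           (-[1+ j ] , j≤k , Pc) → suc j , j≤k , inj₂ Pc)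
  (search-ℕ k λ j → P? (+ j) ⊎-dec P? (- + j))

search-box : ∀ (b : ℕVec n) {P : Pred (ℤVec n) 0ℓ} → (∀ {x y} → x ≗ y → P x → P y) → Decidable P →
             Dec (∃ λ a → (∀ i → ∣ a i ∣ ℕ.≤ b i) × P a)
search-box {zero} b resp P? = Dec.map′
  (λ Pa → []ᵥ , (λ ()) , Pa)
  (λ (a , _ , Pa) → resp (λ ()) Pa)
  (P? []ᵥ)
search-box {suc n} b resp P? = Dec.map′
  (λ (c , c≤ , a , a≤ , Pc∷a) → c ∷ᵥ a , (λ { zero → c≤ ; (suc i) → a≤ i }) , Pc∷a)
  (λ (a , a≤ , Pa) → head a , a≤ zero , tail a , a≤ ∘ suc , resp (λ { zero → refl ; (suc i) → refl }) Pa)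
  (search-ℤ (head b) λ c →
    search-box (tail b) (λ x≗y → resp λ { zero → refl ; (suc i) → x≗y i }) (P? ∘ (c ∷ᵥ_)))


-- Integer spans of finite lists

0ℤᵥ : ℤVec n
0ℤᵥ _ = 0ℤ

infixl 7 _·ℤᵥ_
infixl 6 _-ℤᵥ_

_-ℤᵥ_ : ℤVec n → ℤVec n → ℤVec n
(x -ℤᵥ y) i = x i - y i

_·ℤᵥ_ : ℤ → ℤVec n → ℤVec n
(c ·ℤᵥ x) i = c * x i

infixr 5 _∷ˢ_

data Span {n} : List (ℤVec n) → Pred (ℤVec n) 0ℓ where
  []ˢ  : ∀ {x} → x ≗ 0ℤᵥ → Span [] x
  _∷ˢ_ : ∀ {g G x} (c : ℤ) → Span G (x -ℤᵥ c ·ℤᵥ g) → Span (g ∷ G) x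

span-resp : ∀ {G : List (ℤVec n)} {x y} → Span G x → x ≗ y → Span G y
span-resp ([]ˢ x≗0) x≗y = []ˢ λ i → trans (sym (x≗y i)) (x≗0 i)
span-resp (c ∷ˢ s) x≗y = c ∷ˢ span-resp s (λ i → cong (_- _) (x≗y i))

span-0 : ∀ {G : List (ℤVec n)} → Span G 0ℤᵥ
span-0 {G = []} = []ˢ λ _ → refl
span-0 {G = g ∷ G} = 0ℤ ∷ˢ span-resp span-0 λ i → refl

span-+ : ∀ {G : List (ℤVec n)} {x y} → Span G x → Span G y → Span G (x +ℤᵥ y)
span-+ ([]ˢ x≗0) ([]ˢ y≗0) = []ˢ λ i → cong₂ _+_ (x≗0 i) (y≗0 i)
span-+ {x = x} {y} (c ∷ˢ s) (d ∷ˢ t) = c + d ∷ˢ span-resp (span-+ s t) λ i → regroup (x i) (y i) c d _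
  where
  regroup : ∀ a b c d e → (a - c * e) + (b - d * e) ≡ (a + b) - (c + d) * e
  regroup = solve-∀

span-· : ∀ {G : List (ℤVec n)} {x} k → Span G x → Span G (k ·ℤᵥ x)
span-· k ([]ˢ x≗0) = []ˢ λ i → trans (cong (k *_) (x≗0 i)) (ℤₚ.*-zeroʳ k)
span-· {x = x} k (c ∷ˢ s) = k * c ∷ˢ span-resp (span-· k s) λ i → distrib k (x i) c _
  where
  distrib : ∀ k a c e → k * (a - c * e) ≡ k * a - k * c * e
  distrib = solve-∀

span-there : ∀ {g} {G : List (ℤVec n)} → Span G ⊆ Span (g ∷ G)
span-there {x = x} s = 0ℤ ∷ˢ span-resp s λ i → sym (ℤₚ.+-identityʳ (x i))

span-∈ : ∀ {g} {G : List (ℤVec n)} → g ∈ G → Span G g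
span-∈ {g = g} (here refl) = 1ℤ ∷ˢ span-resp span-0 λ i → sym (ℤₚ.i≡j⇒i-j≡0 (sym (ℤₚ.*-identityˡ (g i))))
span-∈ (there g∈G) = span-there (span-∈ g∈G)

span-⊆ : ∀ {G H : List (ℤVec n)} → (∀ {g} → g ∈ G → Span H g) → Span G ⊆ Span H
span-⊆ G⊆H ([]ˢ x≗0) = span-resp span-0 λ i → sym (x≗0 i)
span-⊆ G⊆H {x} (c ∷ˢ s) =
  span-resp (span-+ (span-⊆ (G⊆H ∘ there) s) (span-· c (G⊆H (here refl)))) λ i → cancel (x i) c _
  where
  cancel : ∀ a c e → (a - c * e) + c * e ≡ a
  cancel = solve-∀

span-∷⁺ : ∀ {g} {G H : List (ℤVec n)} → Span G ⊆ Span H → Span (g ∷ G) ⊆ Span (g ∷ H)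
span-∷⁺ G⊆H (c ∷ˢ s) = c ∷ˢ G⊆H s

span-pair-⊆ : ∀ {g p g′ p′ : ℤVec n} {R} a b c d →
  (∀ i → g i ≡ a * g′ i + b * p′ i) → (∀ i → p i ≡ c * g′ i + d * p′ i) →
  Span (g ∷ p ∷ R) ⊆ Span (g′ ∷ p′ ∷ R)
span-pair-⊆ {g = g} {p} {g′} {p′} {R} a b c d g≡ p≡ = span-⊆ λ where
    (here refl) → combination a b g≡
    (there (here refl)) → combination c d p≡
    (there (there r∈R)) → span-there (span-there (span-∈ r∈R))
  where
  cancel : ∀ e f u v → e * u + f * v - e * u - f * v ≡ 0ℤ
  cancel = solve-∀
  combination : ∀ {x} e f → (∀ i → x i ≡ e * g′ i + f * p′ i) → Span (g′ ∷ p′ ∷ R) x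
  combination e f x≡ = e ∷ˢ f ∷ˢ span-resp span-0 λ i →
    sym (trans (cong (λ z → z - e * g′ i - f * p′ i) (x≡ i)) (cancel e f (g′ i) (p′ i)))

lattice-resp : ∀ {B : Fin m → ℤVec n} {x y} → x ≗ y → InLattice B x → InLattice B y
lattice-resp x≗y (c , x≡) = c , λ i → trans (sym (x≗y i)) (x≡ i)

lattice⊆span : ∀ (B : Fin m → ℤVec n) → InLattice B ⊆ Span (tabulate B)
lattice⊆span {m = zero} B (c , x≡) = []ˢ x≡
lattice⊆span {m = suc m} B (c , x≡) =
  c zero ∷ˢ lattice⊆span (B ∘ suc) (c ∘ suc , λ i → i≡j+k⇒i-j≡k _ _ (x≡ i))

span⊆lattice : ∀ (B : Fin m → ℤVec n) → Span (tabulate B) ⊆ InLattice B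
span⊆lattice {m = zero} B ([]ˢ x≗0) = (λ ()) , x≗0
span⊆lattice {m = suc m} B {x} (c ∷ˢ s) =
  let c′ , x′≡ = span⊆lattice (B ∘ suc) s in
  c ∷ᵥ c′ , λ i → i-j≡k⇒i≡j+k (x i) _ (x′≡ i)

lattice-· : ∀ {B : Fin m → ℤVec n} {x} k → InLattice B x → InLattice B (k ·ℤᵥ x)
lattice-· {B = B} k x∈L = span⊆lattice B (span-· k (lattice⊆span B x∈L))


-- Pivoting, and deciding membership in a span

record PairReduction (i : Fin n) (g p : ℤVec n) : Set where
  field
    p′ q : ℤVec n
    q-i≡0 : q i ≡ 0ℤ
    span⊆ : ∀ {R} → Span (g ∷ p ∷ R) ⊆ Span (p′ ∷ q ∷ R)
    span⊇ : ∀ {R} → Span (p′ ∷ q ∷ R) ⊆ Span (g ∷ p ∷ R)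

-- (g, p) ↦ (s g + t p, β g − α p) has determinant −(α s + β t) = −1, and the
-- second vector vanishes at i because β (α d) = α (β d).
reduce-pair : ∀ (i : Fin n) g p → PairReduction i g p
reduce-pair i g p = record
  { p′ = p′ ; q = q
  ; q-i≡0 = trans (cong₂ (λ a b → β * a + - α * b) a≡αd b≡βd) (cross α β d)
  ; span⊆ = span-pair-⊆ α t β (- s) (λ j → sym (unimodular (invert-g α β s t (g j) (p j))))
                                      (λ j → sym (unimodular (invert-p α β s t (g j) (p j))))
  ; span⊇ = span-pair-⊆ s t β (- α) (λ _ → refl) (λ _ → refl) }
  where
  open Bézout (bézout (g i) (p i))
  p′ q : ℤVec _
  p′ j = s * g j + t * p j
  q j = β * g j + - α * p j
  unimodular : ∀ {x y} → x ≡ (α * s + β * t) * y → x ≡ y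
  unimodular {y = y} eq = trans eq (trans (cong (_* y) αs+βt≡1) (ℤₚ.*-identityˡ y))
  cross : ∀ α β d → β * (α * d) + - α * (β * d) ≡ 0ℤ
  cross = solve-∀
  invert-g : ∀ α β s t x y → α * (s * x + t * y) + t * (β * x + - α * y) ≡ (α * s + β * t) * x
  invert-g = solve-∀
  invert-p : ∀ α β s t x y → β * (s * x + t * y) + - s * (β * x + - α * y) ≡ (α * s + β * t) * y
  invert-p = solve-∀

record Pivot (i : Fin n) (G : List (ℤVec n)) : Set where
  field
    pivot : ℤVec n
    rest : List (ℤVec n)
    rest-i≡0 : All (λ r → r i ≡ 0ℤ) rest
    span⊆ : Span G ⊆ Span (pivot ∷ rest)
    span⊇ : Span (pivot ∷ rest) ⊆ Span G

pivot-at : ∀ (i : Fin n) G → Pivot i G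
pivot-at i [] = record
  { pivot = 0ℤᵥ ; rest = [] ; rest-i≡0 = []
  ; span⊆ = span-there ; span⊇ = span-⊆ λ { (here refl) → span-0 } }
pivot-at i (g ∷ G) = record
  { pivot = p′ ; rest = q ∷ rest ; rest-i≡0 = q-i≡0 ∷ rest-i≡0
  ; span⊆ = λ s → span⊆ (span-∷⁺ P.span⊆ s)
  ; span⊇ = λ s → span-∷⁺ P.span⊇ (span⊇ s) }
  where
  module P = Pivot (pivot-at i G)
  open P using (rest; rest-i≡0)
  open PairReduction (reduce-pair i g P.pivot)

span-column-zero : ∀ {i : Fin n} {R x} → All (λ r → r i ≡ 0ℤ) R → Span R x → x i ≡ 0ℤ
span-column-zero [] ([]ˢ x≗0) = x≗0 _
span-column-zero {i = i} {x = x} (r-i≡0 ∷ R-i≡0) (c ∷ˢ s) =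
  trans (sym (trans (cong (λ z → x i - c * z) r-i≡0) (x-c*0≡x (x i) c))) (span-column-zero R-i≡0 s)

span-map-tail : ∀ {R : List (ℤVec (suc n))} → Span R ⊆ (Span (map tail R) ∘ tail)
span-map-tail ([]ˢ x≗0) = []ˢ (x≗0 ∘ suc)
span-map-tail (c ∷ˢ s) = c ∷ˢ span-map-tail s

span-untail : ∀ {R : List (ℤVec (suc n))} {x} → All (λ r → head r ≡ 0ℤ) R →
              head x ≡ 0ℤ → Span (map tail R) (tail x) → Span R x
span-untail [] x₀≡0 ([]ˢ x≗0) = []ˢ λ where
  zero → x₀≡0
  (suc i) → x≗0 i
span-untail {x = x} (r₀≡0 ∷ R₀≡0) x₀≡0 (c ∷ˢ s) =
  c ∷ˢ span-untail R₀≡0 (trans (cong (λ z → head x - c * z) r₀≡0) (trans (x-c*0≡x _ c) x₀≡0)) s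

span-dim0 : ∀ G (x : ℤVec 0) → Span G x
span-dim0 [] x = []ˢ λ ()
span-dim0 (g ∷ G) x = 0ℤ ∷ˢ span-dim0 G _

coefficient-bound : ∀ {x c a} → a ≢ 0ℤ → x - c * a ≡ 0ℤ → ∣ c ∣ ℕ.≤ ∣ x ∣
coefficient-bound {x} {c} {a} a≢0 x-ca≡0 rewrite ℤₚ.i-j≡0⇒i≡j x (c * a) x-ca≡0 | ℤₚ.abs-* c a =
  ℕₚ.m≤m*n ∣ c ∣ ∣ a ∣ {{ℕ.≢-nonZero (a≢0 ∘ ℤₚ.∣i∣≡0⇒i≡0)}}

span? : ∀ (G : List (ℤVec n)) → Decidable (Span G)
span?-head-zero : ∀ {R : List (ℤVec (suc n))} → All (λ r → head r ≡ 0ℤ) R → Decidable (Span R)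

span? {zero} G x = yes (span-dim0 G x)
span? {suc n} G x = Dec.map′ span⊇ span⊆ (pivot-span? (head pivot ℤₚ.≟ 0ℤ))
  where
  open Pivot (pivot-at zero G)
  pivot-span? : Dec (head pivot ≡ 0ℤ) → Dec (Span (pivot ∷ rest) x)
  pivot-span? (yes p₀≡0) = span?-head-zero (p₀≡0 ∷ rest-i≡0) x
  -- the rest vanishes at coordinate 0, so the pivot coefficient c solves
  -- x₀ = c p₀, which bounds the search
  pivot-span? (no p₀≢0) = Dec.map′
    (λ (c , _ , s) → c ∷ˢ s)
    (λ { (c ∷ˢ s) → c , coefficient-bound {x = head x} {c} p₀≢0 (span-column-zero rest-i≡0 s) , s })
    (search-ℤ ∣ head x ∣ λ c → span?-head-zero rest-i≡0 (x -ℤᵥ c ·ℤᵥ pivot))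

span?-head-zero {R = R} R₀≡0 x = Dec.map′
  (λ (x₀≡0 , s) → span-untail R₀≡0 x₀≡0 s)
  (λ s → span-column-zero R₀≡0 s , span-map-tail s)
  (head x ℤₚ.≟ 0ℤ ×-dec span? (map tail R) (tail x))

lattice? : ∀ (B : Fin m → ℤVec n) → Decidable (InLattice B)
lattice? B x = Dec.map′ (span⊆lattice B) (lattice⊆span B) (span? (tabulate B) x)


-- Finite generating sets of sublattices

record Generators (L : Pred (ℤVec n) 0ℓ) : Set where
  field
    gens : List (ℤVec n)
    gens⊆ : Span gens ⊆ L
    ⊆gens : L ⊆ Span gens

generators-cong : ∀ {L L′ : Pred (ℤVec n) 0ℓ} → L ⊆ L′ → L′ ⊆ L → Generators L → Generators L′
generators-cong L⊆L′ L′⊆L 𝓖 = record { gens = gens ; gens⊆ = L⊆L′ ∘ gens⊆ ; ⊆gens = ⊆gens ∘ L′⊆L }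
  where open Generators 𝓖

lattice-generators : (B : Fin m → ℤVec n) → Generators (InLattice B)
lattice-generators B = record { gens = tabulate B ; gens⊆ = span⊆lattice B ; ⊆gens = lattice⊆span B }

slice : ∀ {L : Pred (ℤVec n) 0ℓ} (i : Fin n) → Generators L → Generators (L ∩ λ y → y i ≡ 0ℤ)
slice {L = L} i 𝓖 = slice′ (pivot i ℤₚ.≟ 0ℤ)
  where
  open Generators 𝓖
  open Pivot (pivot-at i gens)
  drop-pivot : ∀ {y} → pivot i ≢ 0ℤ → Span (pivot ∷ rest) y → y i ≡ 0ℤ → Span rest y
  drop-pivot {y} pᵢ≢0 (c ∷ˢ s) yᵢ≡0
    with ℤₚ.i*j≡0⇒i≡0∨j≡0 c (trans (sym (ℤₚ.i-j≡0⇒i≡j _ _ (span-column-zero rest-i≡0 s))) yᵢ≡0)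
  ... | inj₁ refl = span-resp s λ j → ℤₚ.+-identityʳ (y j)
  ... | inj₂ pᵢ≡0 = ⊥-elim (pᵢ≢0 pᵢ≡0)
  slice′ : Dec (pivot i ≡ 0ℤ) → Generators (L ∩ λ y → y i ≡ 0ℤ)
  slice′ (yes pᵢ≡0) = record
    { gens = pivot ∷ rest
    ; gens⊆ = λ s → gens⊆ (span⊇ s) , span-column-zero (pᵢ≡0 ∷ rest-i≡0) s
    ; ⊆gens = λ (y∈L , _) → span⊆ (⊆gens y∈L) }
  slice′ (no pᵢ≢0) = record
    { gens = rest
    ; gens⊆ = λ s → gens⊆ (span⊇ (span-there s)) , span-column-zero rest-i≡0 s
    ; ⊆gens = λ (y∈L , yᵢ≡0) → drop-pivot pᵢ≢0 (span⊆ (⊆gens y∈L)) yᵢ≡0 }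

slices : ∀ {L : Pred (ℤVec n) 0ℓ} (cs : List (Fin n)) → Generators L →
         Generators (L ∩ λ y → All (λ i → y i ≡ 0ℤ) cs)
slices [] 𝓖 = generators-cong (_, []) proj₁ 𝓖
slices (i ∷ cs) 𝓖 = generators-cong
  (λ ((y∈L , ys≡0) , yᵢ≡0) → y∈L , yᵢ≡0 ∷ ys≡0)
  (λ { (y∈L , yᵢ≡0 ∷ ys≡0) → (y∈L , ys≡0) , yᵢ≡0 })
  (slice i (slices cs 𝓖))

SupportedIn : ℕVec n → Pred (ℤVec n) 0ℓ
SupportedIn v y = ∀ i → v i ≡ 0 → y i ≡ 0ℤ

restrict-support : ∀ {L : Pred (ℤVec n) 0ℓ} (v : ℕVec n) → Generators L → Generators (L ∩ SupportedIn v)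
restrict-support {n} v 𝓖 = generators-cong
  (λ (y∈L , zs) → y∈L , λ i vᵢ≡0 → All.lookup zs (∈-filter⁺ zero? (∈-allFin i) vᵢ≡0))
  (λ (y∈L , supp) → y∈L , All.tabulate λ i∈ →
    let _ , vᵢ≡0 = ∈-filter⁻ zero? {xs = allFin n} i∈ in supp _ vᵢ≡0)
  (slices (filter zero? (allFin n)) 𝓖)
  where
  zero? : ∀ i → Dec (v i ≡ 0)
  zero? i = v i ℕₚ.≟ 0

has-nonzero? : ∀ {L : Pred (ℤVec n) 0ℓ} → Generators L → Dec (∃ λ y → L y × NonZero y)
has-nonzero? {L = L} 𝓖 = decide (All.all? zero-vector? gens)
  where
  open Generators 𝓖
  zero-vector? : Decidable λ g → ∀ i → g i ≡ 0ℤ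
  zero-vector? g = Finₚ.all? λ i → g i ℤₚ.≟ 0ℤ
  decide : Dec (All (λ g → ∀ i → g i ≡ 0ℤ) gens) → Dec (∃ λ y → L y × NonZero y)
  decide (yes gens≡0) = no λ (y , y∈L , y≢0) →
    y≢0 λ i → span-column-zero (All.map (λ g≡0 → g≡0 i) gens≡0) (⊆gens y∈L)
  decide (no gens≢0) =
    let g , g∈gens , g≢0 = find (¬All⇒Any¬ zero-vector? gens gens≢0) in yes (g , gens⊆ (span-∈ g∈gens) , g≢0)


-- Orthants and Hilbert bases

-- Defs states the orthant condition through a local function that cannot be
-- named here; OrthantCond restates it, and the next two lemmas translate.
OrthantCond : Bool → ℤ → Set
OrthantCond true x = x ≥ 0ℤ
OrthantCond false x = x ≤ 0ℤ

orthant⇒cond : ∀ {ρ : Fin n → Bool} {x} → InOrthant ρ x → ∀ i → OrthantCond (ρ i) (x i)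
orthant⇒cond {ρ = ρ} x∈R i with ρ i | x∈R i
... | true | xᵢ≥0 = xᵢ≥0
... | false | xᵢ≤0 = xᵢ≤0

cond⇒orthant : ∀ {ρ : Fin n → Bool} {x} → (∀ i → OrthantCond (ρ i) (x i)) → InOrthant ρ x
cond⇒orthant {ρ = ρ} conds i with ρ i | conds i
... | true | xᵢ≥0 = xᵢ≥0
... | false | xᵢ≤0 = xᵢ≤0

orthant-resp : ∀ {ρ : Fin n → Bool} {x y} → x ≗ y → InOrthant ρ x → InOrthant ρ y
orthant-resp {ρ = ρ} x≗y x∈R = cond⇒orthant λ i → subst (OrthantCond (ρ i)) (x≗y i) (orthant⇒cond x∈R i)

orthant? : ∀ (ρ : Fin n → Bool) → Decidable (InOrthant ρ)
orthant? ρ x = Dec.map′ cond⇒orthant orthant⇒cond (Finₚ.all? λ i → cond? (ρ i) (x i))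
  where
  cond? : ∀ s z → Dec (OrthantCond s z)
  cond? true z = 0ℤ ℤₚ.≤? z
  cond? false z = z ℤₚ.≤? 0ℤ

∣+∣-same-orthant : ∀ s {x y} → OrthantCond s x → OrthantCond s y → ∣ x + y ∣ ≡ ∣ x ∣ ℕ.+ ∣ y ∣
∣+∣-same-orthant true {+ a} {+ b} _ _ = refl
∣+∣-same-orthant true { -[1+ a ]} () _
∣+∣-same-orthant true {+ a} { -[1+ b ]} _ ()
∣+∣-same-orthant false {+[1+ a ]} (+≤+ ()) _
∣+∣-same-orthant false {y = +[1+ b ]} _ (+≤+ ())
∣+∣-same-orthant false {+0} {+0} _ _ = refl
∣+∣-same-orthant false {+0} { -[1+ b ]} _ _ = refl
∣+∣-same-orthant false { -[1+ a ]} {+0} _ _ = cong suc (sym (ℕₚ.+-identityʳ a))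
∣+∣-same-orthant false { -[1+ a ]} { -[1+ b ]} _ _ = cong suc (sym (ℕₚ.+-suc a b))

nonnegative : ℤ → Bool
nonnegative (+ _) = true
nonnegative -[1+ _ ] = false

in-sign-orthant : ∀ (x : ℤVec n) → InOrthant (nonnegative ∘ x) x
in-sign-orthant x = cond⇒orthant λ i → cond (x i)
  where
  cond : ∀ z → OrthantCond (nonnegative z) z
  cond (+ a) = +≤+ z≤n
  cond -[1+ a ] = -≤+

size : ℤVec n → ℕ
size x = sumℕ λ i → ∣ x i ∣

size>0 : ∀ {x : ℤVec n} → NonZero x → 0 ℕ.< size x
size>0 {x = x} x≢0 = ℕₚ.n≢0⇒n>0 λ size≡0 →
  x≢0 λ i → ℤₚ.∣i∣≡0⇒i≡0 (ℕₚ.n≤0⇒n≡0 (subst (∣ x i ∣ ℕ.≤_) size≡0 (term≤sum _ i)))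

nonzero-resp : ∀ {x y : ℤVec n} → x ≗ y → NonZero x → NonZero y
nonzero-resp x≗y x≢0 y≡0 = x≢0 λ i → trans (x≗y i) (y≡0 i)

nonzero? : Decidable (NonZero {n})
nonzero? x = ¬? (Finₚ.all? λ i → x i ℤₚ.≟ 0ℤ)

module HilbertBasis (B : Fin m → ℤVec n) (ρ : Fin n → Bool) where

  Cone⁺ : Pred (ℤVec n) 0ℓ
  Cone⁺ x = InLattice B x × InOrthant ρ x × NonZero x

  cone⁺-resp : ∀ {x y} → x ≗ y → Cone⁺ x → Cone⁺ y
  cone⁺-resp x≗y (x∈L , x∈R , x≢0) = lattice-resp x≗y x∈L , orthant-resp x≗y x∈R , nonzero-resp x≗y x≢0

  cone⁺? : Decidable Cone⁺
  cone⁺? x = lattice? B x ×-dec orthant? ρ x ×-dec nonzero? x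

  ProperSummand : ℤVec n → Pred (ℤVec n) 0ℓ
  ProperSummand g a = Cone⁺ a × Cone⁺ (g -ℤᵥ a)

  summand-resp : ∀ {g a a′} → a ≗ a′ → ProperSummand g a → ProperSummand g a′
  summand-resp {g} a≗a′ (a∈C , g-a∈C) = cone⁺-resp a≗a′ a∈C , cone⁺-resp (λ i → cong (λ z → g i - z) (a≗a′ i)) g-a∈C

  ∣summand∣ : ∀ {g a} → ProperSummand g a → ∀ i → ∣ g i ∣ ≡ ∣ a i ∣ ℕ.+ ∣ g i - a i ∣
  ∣summand∣ {g} {a} ((_ , a∈R , _) , (_ , g-a∈R , _)) i = trans (cong ∣_∣ (i-j≡k⇒i≡j+k (g i) (a i) refl))
    (∣+∣-same-orthant (ρ i) (orthant⇒cond a∈R i) (orthant⇒cond g-a∈R i))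

  summand-smaller : ∀ {g a} → ProperSummand g a → size a ℕ.< size g
  summand-smaller {g} {a} a-summand@(_ , (_ , _ , g-a≢0)) = begin-strict
    size a                                   <⟨ ℕₚ.m<m+n (size a) (size>0 g-a≢0) ⟩
    size a ℕ.+ size (g -ℤᵥ a)                ≡⟨ sum-+ (λ i → ∣ a i ∣) (λ i → ∣ g i - a i ∣) ⟨
    sumℕ (λ i → ∣ a i ∣ ℕ.+ ∣ g i - a i ∣)   ≡⟨ sum-cong (∣summand∣ {g} a-summand) ⟨
    size g                                   ∎
    where open ℕₚ.≤-Reasoning

  summand⇒bounded : ∀ {g a} → ProperSummand g a → ∀ i → ∣ a i ∣ ℕ.≤ ∣ g i ∣
  summand⇒bounded {g} a-summand i = subst (_ ℕ.≤_) (sym (∣summand∣ {g} a-summand i)) (ℕₚ.m≤m+n _ _)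

  summand? : ∀ g → Decidable (ProperSummand g)
  summand? g a = cone⁺? a ×-dec cone⁺? (g -ℤᵥ a)

  no-bounded-summand⇒hilbert : ∀ {g} → Cone⁺ g →
    ¬ (∃ λ a → (∀ i → ∣ a i ∣ ℕ.≤ ∣ g i ∣) × ProperSummand g a) → InHilbertBasis B ρ g
  no-bounded-summand⇒hilbert {g} (g∈L , g∈R , g≢0) no-summand =
    g∈L , g∈R , g≢0 , λ (a , b , a∈L , a∈R , a≢0 , b∈L , b∈R , b≢0 , g≗a+b) →
      let a-summand = (a∈L , a∈R , a≢0) , cone⁺-resp (λ i → sym (i≡j+k⇒i-j≡k _ _ (g≗a+b i))) (b∈L , b∈R , b≢0)
      in no-summand (a , summand⇒bounded {g} a-summand , a-summand)

  hilbert-below : ∀ {g} → Cone⁺ g → ∃ λ h → InHilbertBasis B ρ h × (∀ i → ∣ h i ∣ ℕ.≤ ∣ g i ∣)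
  hilbert-below g∈C = descend g∈C (<-wellFounded _)
    where
    descend : ∀ {g} → Cone⁺ g → Acc ℕ._<_ (size g) → ∃ λ h → InHilbertBasis B ρ h × (∀ i → ∣ h i ∣ ℕ.≤ ∣ g i ∣)
    descend {g} g∈C (acc smaller) with search-box (λ i → ∣ g i ∣) (summand-resp {g}) (summand? g)
    ... | yes (a , a≤g , a-summand) =
      let h , h∈H , h≤a = descend (proj₁ a-summand) (smaller (summand-smaller {g} a-summand))
      in h , h∈H , λ i → ℕₚ.≤-trans (h≤a i) (a≤g i)
    ... | no no-summand = g , no-bounded-summand⇒hilbert g∈C no-summand , λ _ → ℕₚ.≤-refl

graver-below : ∀ {B : Fin m → ℤVec n} {g} → InLattice B g → NonZero g →
               ∃ λ h → InGraver B h × (∀ i → ∣ h i ∣ ℕ.≤ ∣ g i ∣)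
graver-below {B = B} {g} g∈L g≢0 =
  let h , h∈H , h≤g = HilbertBasis.hilbert-below B (nonnegative ∘ g) (g∈L , in-sign-orthant g , g≢0)
  in h , (nonnegative ∘ g , h∈H) , h≤g

hilbert-resp : ∀ {B : Fin m → ℤVec n} {ρ x y} → x ≗ y → InHilbertBasis B ρ x → InHilbertBasis B ρ y
hilbert-resp x≗y (x∈L , x∈R , x≢0 , x-indecomposable) =
  lattice-resp x≗y x∈L , orthant-resp x≗y x∈R , nonzero-resp x≗y x≢0 ,
  λ (a , b , a∈L , a∈R , a≢0 , b∈L , b∈R , b≢0 , y≗a+b) →
    x-indecomposable (a , b , a∈L , a∈R , a≢0 , b∈L , b∈R , b≢0 , λ i → trans (x≗y i) (y≗a+b i))

graver-resp : ∀ {B : Fin m → ℤVec n} {x y} → x ≗ y → InGraver B x → InGraver B y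
graver-resp x≗y (ρ , x∈H) = ρ , hilbert-resp x≗y x∈H


-- Radicals and top-dimensional components of monomial ideals

IsUpClosed : MonIdeal n → Set
IsUpClosed M = ∀ {u w} → u ≤ᵥ w → M u → M w

Rad-mono : ∀ {M N : MonIdeal n} → M ⊆ᴵ N → Rad M ⊆ᴵ Rad N
Rad-mono M⊆N w (k , k>0 , kw∈M) = k , k>0 , M⊆N _ kw∈M

Rad-Rad⊆Rad : ∀ {M : MonIdeal n} → IsUpClosed M → Rad (Rad M) ⊆ᴵ Rad M
Rad-Rad⊆Rad {M = M} M-up w (k , k>0 , l , l>0 , lkw∈M) =
  l ℕ.* k , ℕₚ.*-mono-< l>0 k>0 , M-up (λ i → ℕₚ.≤-reflexive (sym (ℕₚ.*-assoc l k (w i)))) lkw∈M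

Rad-cong : ∀ {M N : MonIdeal n} → IsUpClosed M → M ⊆ᴵ N → N ⊆ᴵ Rad M → Rad M ≐ Rad N
Rad-cong M-up M⊆N N⊆√M w = Rad-mono M⊆N w , λ w∈√N → Rad-Rad⊆Rad M-up w (Rad-mono N⊆√M w w∈√N)

⊆Prime-anti : ∀ {M N : MonIdeal n} {F} → M ⊆ᴵ N → ⊆Prime N F → ⊆Prime M F
⊆Prime-anti M⊆N N⊆F u u∈M = N⊆F u (M⊆N u u∈M)

⊆Prime-Rad : ∀ {M : MonIdeal n} {F} → ⊆Prime M F → ⊆Prime (Rad M) F
⊆Prime-Rad M⊆F u (k , _ , ku∈M) =
  let i , i∈F , kuᵢ>0 = M⊆F _ ku∈M
  in i , i∈F , ℕₚ.n≢0⇒n>0 λ uᵢ≡0 → ℕₚ.<⇒≢ kuᵢ>0 (sym (trans (cong (k ℕ.*_) uᵢ≡0) (ℕₚ.*-zeroʳ k)))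

primaryComponent-mono : ∀ {M N : MonIdeal n} {F} → M ⊆ᴵ N → PrimaryComponent M F ⊆ᴵ PrimaryComponent N F
primaryComponent-mono M⊆N u (w , w∉F , u+w∈M) = w , w∉F , M⊆N _ u+w∈M

Top-mono : ∀ {M N : MonIdeal n} → M ⊆ᴵ N → N ⊆ᴵ Rad M → Top M ⊆ᴵ Top N
Top-mono M⊆N N⊆√M u u∈TopM F (N⊆F , F-minimal) =
  primaryComponent-mono M⊆N u (u∈TopM F (⊆Prime-anti M⊆N N⊆F , λ G M⊆G →
    F-minimal G (⊆Prime-anti N⊆√M (⊆Prime-Rad M⊆G))))


-- The product ideal and the vertex ideal

product-upClosed : ∀ (B : Fin m → ℤVec n) → IsUpClosed (ProductIdeal B)
product-upClosed B u≤w (v , v′ , disjoint , v-v′∈Gr , v+v′≤u) =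
  v , v′ , disjoint , v-v′∈Gr , λ i → ℕₚ.≤-trans (v+v′≤u i) (u≤w i)

graver⇒product : ∀ {B : Fin m → ℤVec n} {h} → InGraver B h → ProductIdeal B (λ i → ∣ h i ∣)
graver⇒product {h = h} h∈Gr =
  (λ i → h i ⁺) , (λ i → h i ⁻) , (λ i → ⁺≡0⊎⁻≡0 (h i)) ,
  graver-resp (λ i → sym (⁺-⁻ (h i))) h∈Gr , λ i → ℕₚ.≤-reflexive (⁺+⁻ (h i))

midpoint-not-vertex : ∀ {B : Fin m → ℤVec n} {u u′} → InLattice B (u -ᵥ u′) → NonZero (u -ᵥ u′) →
                      ConvCombOfOthers B (u +ᵥ u′) (u +ᵥ u′)
midpoint-not-vertex {u = u} {u′} u-u′∈L u-u′≢0 =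
  2 , ends , (λ _ → 1) , ends∈fiber , ends≢mid , s≤s z≤n , λ i → balance (u i) (u′ i)
  where
  balance : ∀ a b → 2 ℕ.* (a ℕ.+ b) ≡ 1 ℕ.* (a ℕ.+ a) ℕ.+ (1 ℕ.* (b ℕ.+ b) ℕ.+ 0)
  balance = ℕ-solve-∀
  left : ∀ a b → + (a ℕ.+ b) - + (a ℕ.+ a) ≡ -1ℤ * (+ a - + b)
  left a b rewrite ℤₚ.pos-+ a b | ℤₚ.pos-+ a a = regroup (+ a) (+ b)
    where
    regroup : ∀ x y → x + y - (x + x) ≡ -1ℤ * (x - y)
    regroup = solve-∀
  right : ∀ a b → + (a ℕ.+ b) - + (b ℕ.+ b) ≡ + a - + b
  right a b rewrite ℤₚ.pos-+ a b | ℤₚ.pos-+ b b = regroup (+ a) (+ b)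
    where
    regroup : ∀ x y → x + y - (y + y) ≡ x - y
    regroup = solve-∀
  ends : Fin 2 → ℕVec _
  ends zero = u +ᵥ u
  ends (suc zero) = u′ +ᵥ u′
  ends∈fiber : ∀ j → InFiber _ (u +ᵥ u′) (ends j)
  ends∈fiber zero = lattice-resp (λ i → sym (left (u i) (u′ i))) (lattice-· -1ℤ u-u′∈L)
  ends∈fiber (suc zero) = lattice-resp (λ i → sym (right (u i) (u′ i))) u-u′∈L
  ends≢mid : ∀ j → ¬ (∀ i → ends j i ≡ (u +ᵥ u′) i)
  ends≢mid zero eq = u-u′≢0 λ i → ℤₚ.i≡j⇒i-j≡0 (cong +_ (ℕₚ.+-cancelˡ-≡ (u i) _ _ (eq i)))
  ends≢mid (suc zero) eq = u-u′≢0 λ i → ℤₚ.i≡j⇒i-j≡0 (cong +_ (sym (ℕₚ.+-cancelʳ-≡ (u′ i) _ _ (eq i))))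

product⊆vertex : ∀ (B : Fin m → ℤVec n) → ProductIdeal B ⊆ᴵ VertexIdeal B
product⊆vertex B w (u , u′ , _ , (_ , u-u′∈L , _ , u-u′≢0 , _) , u+u′≤w) =
  u +ᵥ u′ , u+u′≤w , λ (_ , not-combination) → not-combination (midpoint-not-vertex {u = u} {u′} u-u′∈L u-u′≢0)

fiber-refl : ∀ {B : Fin m → ℤVec n} v → InFiber B v v
fiber-refl {B = B} v = lattice-resp (λ i → sym (ℤₚ.+-inverseʳ (+ v i))) (span⊆lattice B span-0)

combination⇒supported : ∀ {B : Fin m → ℤVec n} {v} → ConvCombOfOthers B v v →
                        ∃ λ y → (InLattice B ∩ SupportedIn v) y × NonZero y
combination⇒supported {v = v} (k , w , λ′ , w∈fiber , w≢v , Σλ′>0 , balance) =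
  v -ᵥ w j , (w∈fiber j , supported) , λ v-wⱼ≡0 → w≢v j λ i → sym (ℤₚ.+-injective (ℤₚ.i-j≡0⇒i≡j _ _ (v-wⱼ≡0 i)))
  where
  positive-weight : ∃ λ j → 0 ℕ.< λ′ j
  positive-weight = sum>0⇒term>0 λ′ Σλ′>0
  j : Fin k
  j = proj₁ positive-weight
  wⱼ≡0 : ∀ i → v i ≡ 0 → w j i ≡ 0
  wⱼ≡0 i vᵢ≡0 with ℕₚ.m*n≡0⇒m≡0∨n≡0 (λ′ j) (ℕₚ.n≤0⇒n≡0 (begin
    λ′ j ℕ.* w j i                ≤⟨ term≤sum (λ j → λ′ j ℕ.* w j i) j ⟩
    sumℕ (λ j → λ′ j ℕ.* w j i)   ≡⟨ balance i ⟨
    sumℕ λ′ ℕ.* v i               ≡⟨ cong (sumℕ λ′ ℕ.*_) vᵢ≡0 ⟩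
    sumℕ λ′ ℕ.* 0                 ≡⟨ ℕₚ.*-zeroʳ (sumℕ λ′) ⟩
    0                             ∎))
    where open ℕₚ.≤-Reasoning
  ... | inj₁ λ′ⱼ≡0 = ⊥-elim (ℕₚ.<⇒≢ (proj₂ positive-weight) (sym λ′ⱼ≡0))
  ... | inj₂ wⱼᵢ≡0 = wⱼᵢ≡0
  supported : SupportedIn v (v -ᵥ w j)
  supported i vᵢ≡0 = cong₂ (λ a b → + a - + b) vᵢ≡0 (wⱼ≡0 i vᵢ≡0)

-- Being a vertex is only refuted, so such a y is found by deciding whether 𝓛
-- contains one at all; if not, no convex combination exists and v is a vertex.
nonvertex⇒supported : ∀ {B : Fin m → ℤVec n} {v} → ¬ IsVertexOfFiber B v v →
                      ∃ λ y → (InLattice B ∩ SupportedIn v) y × NonZero y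
nonvertex⇒supported {B = B} {v} v-not-vertex with has-nonzero? (restrict-support v (lattice-generators B))
... | yes y = y
... | no none = ⊥-elim (v-not-vertex (fiber-refl v , none ∘ combination⇒supported))

nonvertex⇒power∈product : ∀ {B : Fin m → ℤVec n} {v} → ¬ IsVertexOfFiber B v v →
                          Rad (ProductIdeal B) v
nonvertex⇒power∈product {B = B} {v} v-not-vertex with nonvertex⇒supported v-not-vertex
... | y , (y∈L , y-supported) , y≢0 with graver-below y∈L y≢0
... | h , h∈Gr , h≤y = suc (size h) , s≤s z≤n , product-upClosed B ∣h∣≤kv (graver⇒product h∈Gr)
  where
  ∣h∣≤kv : (λ i → ∣ h i ∣) ≤ᵥ (suc (size h) *ᵥ v)
  ∣h∣≤kv i with v i ℕₚ.≟ 0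
  ... | yes vᵢ≡0 = ℕₚ.≤-trans (h≤y i) (subst (ℕ._≤ _) (sym (cong ∣_∣ (y-supported i vᵢ≡0))) z≤n)
  ... | no vᵢ≢0 = ℕₚ.≤-trans (term≤sum _ i) (ℕₚ.≤-trans (ℕₚ.n≤1+n _) (ℕₚ.m≤m*n _ (v i) {{ℕ.≢-nonZero vᵢ≢0}}))

vertex⊆rad-product : ∀ (B : Fin m → ℤVec n) → VertexIdeal B ⊆ᴵ Rad (ProductIdeal B)
vertex⊆rad-product B w (v , v≤w , v-not-vertex) =
  let k , k>0 , kv∈P = nonvertex⇒power∈product v-not-vertex
  in k , k>0 , product-upClosed B (λ i → ℕₚ.*-monoʳ-≤ k (v≤w i)) kv∈P

corollary4p7 : ∀ {n m : ℕ} (B : Fin m → ℤVec n) →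
    (Rad (ProductIdeal B) ≐ Rad (VertexIdeal B)) ×
    (Top (ProductIdeal B) ⊆ᴵ Top (VertexIdeal B))
corollary4p7 B =
  Rad-cong (product-upClosed B) (product⊆vertex B) (vertex⊆rad-product B) ,
  Top-mono (product⊆vertex B) (vertex⊆rad-product B)
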